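{- Let $G$ be a finite connected plane graph of maximum degree $4$ with an ortho-radial representation satisfying Conditions (1) and (2). Let $f$ be a regular face of $G$ and $u$ any vertex on $f$. If $e$ is an edge on $f$ with $\mathrm{rot}(f[u,e])\le 2$, then there is a candidate on $f[e,u]$, i.e., an edge $e'$ on the part of the boundary walk of $f$ from $e$ to $u$ with $\mathrm{rot}(f[u,e'])=2$.
   Context: $G$ has a fixed combinatorial embedding with designated outer and central faces (possibly equal); other faces are regular. The boundary of a face $f$ is the closed walk with $f$ locally to the right. Ortho-radial representation: a value in $\{90,180,270,360\}$ for each angle of each face. $\mathrm{rot}(uvw)=2-\alpha/90$, $\alpha$ the total angle at $v$ of faces locally to the right of $uvw$ between $vu$ and $vw$; $\mathrm{rot}(uvu)=-2$. Rotation of a walk: sum at internal vertices. $f[u,e]$: subwalk of the boundary walk of $f$ starting at $u$ and ending with edge $e$; $f[e,u]$: subwalk starting with $e$ and ending at $u$. Condition (1): angles at each vertex sum to $360$. Condition (2): boundary rotation (sum over all vertices) is $4$ for regular faces, $0$ for outer or central but not both, $-4$ if both. -}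

module Defs where

open import Data.Nat using (ℕ; zero; suc; _≤_; _<_; _*_; _+_)
open import Data.Integer as ℤ using (ℤ; +_; -[1+_])
open import Data.Fin using (Fin; _≟_)
open import Data.List using (List; []; _∷_; filter; length; map; foldr)
open import Data.List.Base using (allFin)
open import Data.Product using (Σ; ∃; ∃-syntax; _×_; _,_)
open import Relation.Binary.PropositionalEquality using (_≡_; _≢_)
open import Relation.Nullary using (Dec; yes; no; ¬_)

iter : {A : Set} → (A → A) → ℕ → A → A
iter f zero x = x
iter f (suc k) x = iter f k (f x)

sumℤ : List ℤ → ℤ
sumℤ = foldr ℤ._+_ (+ 0)

-- A finite connected plane graph with a fixed combinatorial embedding,
-- given as a rotation system on darts (directed half-edges).
--   * vertices : Fin nV, darts : Fin nD, faces : Fin nF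
--   * rev d : the reverse dart of d (fixed-point-free involution), edges = pairs {d, rev d}
--   * tail d : the vertex where d starts; head d = tail (rev d)
--   * σ : the cyclic (counter-clockwise) order of darts around their tail vertex
--   * next d = σ (rev d) : the dart following d on the boundary walk of the face
--     containing d (this face lies locally to the right of d)
--   * faceOf d : the face whose boundary walk traverses d; faces are exactly
--     the orbits of next
--   * planarity: Euler's formula V - E + F = 2 (E = nD / 2), i.e. 2(V + F) = 4 + nD
record PlaneGraph : Set where
  field
    nV nD nF : ℕ
    tail : Fin nD → Fin nV
    rev : Fin nD → Fin nD
    rev-invol : ∀ d → rev (rev d) ≡ d
    rev-nofix : ∀ d → rev d ≢ d
    σ σ⁻¹ : Fin nD → Fin nD
    σσ⁻¹ : ∀ d → σ (σ⁻¹ d) ≡ d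
    σ⁻¹σ : ∀ d → σ⁻¹ (σ d) ≡ d
    σ-tail : ∀ d → tail (σ d) ≡ tail d
    σ-transitive : ∀ d d' → tail d ≡ tail d' → ∃[ k ] iter σ k d ≡ d'
    faceOf : Fin nD → Fin nF

  head : Fin nD → Fin nV
  head d = tail (rev d)

  next : Fin nD → Fin nD
  next d = σ (rev d)

  field
    faceOf-next : ∀ d → faceOf (next d) ≡ faceOf d
    face-transitive : ∀ d d' → faceOf d ≡ faceOf d' → ∃[ k ] iter next k d ≡ d'
    face-nonempty : ∀ g → ∃[ d ] faceOf d ≡ g
    no-loop : ∀ d → head d ≢ tail d
    no-multi : ∀ d d' → tail d ≡ tail d' → head d ≡ head d' → d ≡ d'
    euler : 2 * (nV + nF) ≡ 4 + nD
    outer central : Fin nF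

  dartsAt : Fin nV → List (Fin nD)
  dartsAt v = filter (λ d → tail d ≟ v) (allFin nD)

  degree : Fin nV → ℕ
  degree v = length (dartsAt v)

  dartsOf : Fin nF → List (Fin nD)
  dartsOf g = filter (λ d → faceOf d ≟ g) (allFin nD)

  faceSize : Fin nF → ℕ
  faceSize g = length (dartsOf g)

data Reach (G : PlaneGraph) : Fin (PlaneGraph.nV G) → Fin (PlaneGraph.nV G) → Set where
  here : ∀ {v} → Reach G v v
  step : ∀ {w} (d : Fin (PlaneGraph.nD G)) →
         Reach G (PlaneGraph.head G d) w → Reach G (PlaneGraph.tail G d) w

Connected : PlaneGraph → Set
Connected G = ∀ v w → Reach G v w

MaxDegree4 : PlaneGraph → Set
MaxDegree4 G = ∀ v → PlaneGraph.degree G v ≤ 4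

data Angle : Set where
  a90 a180 a270 a360 : Angle

deg : Angle → ℕ
deg a90 = 90
deg a180 = 180
deg a270 = 270
deg a360 = 360

-- 2 - α/90
rotAngle : Angle → ℤ
rotAngle a90 = + 1
rotAngle a180 = + 0
rotAngle a270 = -[1+ 0 ]
rotAngle a360 = -[1+ 1 ]

-- The corner of the face faceOf d between the consecutive darts d and next d
-- (at the vertex head d) is identified with the dart d.
OrthoRadialRep : PlaneGraph → Set
OrthoRadialRep G = Fin (PlaneGraph.nD G) → Angle

module _ (G : PlaneGraph) (Γ : OrthoRadialRep G) where
  open PlaneGraph G

  -- rot(u v w) for the consecutive walk u -d-> v -(next d)-> w on a face boundary:
  -- -2 if w = u via the reverse edge (uvu), otherwise 2 - α/90 with α the angle
  -- of the face between vu and vw.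
  rotCorner : Fin nD → ℤ
  rotCorner d with next d ≟ rev d
  ... | yes _ = -[1+ 1 ]
  ... | no _ = rotAngle (Γ d)

  Condition1 : Set
  Condition1 = ∀ v → foldr _+_ 0 (map (λ d → deg (Γ d)) (filter (λ d → head d ≟ v) (allFin nD))) ≡ 360

  faceRot : Fin nF → ℤ
  faceRot g = sumℤ (map rotCorner (dartsOf g))

  data FaceKind (g : Fin nF) : ℤ → Set where
    regular : g ≢ outer → g ≢ central → FaceKind g (+ 4)
    onlyOuter : g ≡ outer → g ≢ central → FaceKind g (+ 0)
    onlyCentral : g ≢ outer → g ≡ central → FaceKind g (+ 0)
    both : g ≡ outer → g ≡ central → FaceKind g (ℤ.- (+ 4))

  Condition2 : Set
  Condition2 = ∀ g → FaceKind g (faceRot g)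

  -- rot(f[u,e]) where the walk starts at u = tail d₀ with first edge d₀ and
  -- e = iter next i d₀ is the i-th edge of the boundary walk after d₀ (0-based):
  -- the sum of the rotations at the internal vertices head(d₀), …, head(d_{i-1}).
  rotPrefix : Fin nD → ℕ → ℤ
  rotPrefix d₀ zero = + 0
  rotPrefix d₀ (suc i) = rotCorner d₀ ℤ.+ rotPrefix (next d₀) i

module Submission where

open import Defs
open import Data.Nat using (ℕ; zero; suc; _+_; _*_; _∸_; _≤_; _<_; z≤n; s≤s)
open import Data.Integer as ℤ using (ℤ; +_)
open import Data.Fin using (Fin; _≟_)
open import Data.Product using (∃-syntax; _×_; _,_; proj₁; proj₂)
open import Relation.Binary.PropositionalEquality
  using (_≡_; _≢_; refl; sym; trans; cong; subst; subst₂; setoid; module ≡-Reasoning)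
import Data.Nat.Properties as ℕₚ
open import Data.Nat.DivMod using (_%_; _/_; m≡m%n+[m/n]*n; m%n<n)
open import Data.Nat.Induction using (<-rec)
import Data.Integer.Properties as ℤₚ
open import Data.List using (List; map; applyUpTo; allFin)
open import Data.List.Properties using (length-applyUpTo)
open import Data.List.Membership.Propositional using (_∈_)
open import Data.List.Membership.Propositional.Properties
  using (∈-applyUpTo⁺; ∈-applyUpTo⁻; ∈-filter⁺; ∈-filter⁻; ∈-allFin)
open import Data.List.Membership.Propositional.Properties.WithK using (unique∧set⇒bag)
open import Data.List.Relation.Unary.Unique.Propositional using (Unique)
import Data.List.Relation.Unary.Unique.Propositional.Properties as Unique
open import Data.List.Relation.Binary.BagAndSetEquality using (∼bag⇒↭)
open import Data.List.Relation.Binary.Permutation.Propositional using (_↭_; ↭⇒↭ₛ)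
open import Data.List.Relation.Binary.Permutation.Propositional.Properties using (↭-length; map⁺)
open import Data.List.Relation.Binary.Permutation.Setoid.Properties using (foldr-commMonoid)
open import Data.Sum using (inj₁; inj₂)
open import Function.Bundles using (mk⇔)
open import Relation.Nullary using (yes; no; ¬_; contradiction)
open import Relation.Unary using (Decidable)

-- The boundary walk of a face is the orbit of one of its darts under next,
-- so after faceSize steps it has turned by the full face rotation, which is 4
-- for a regular face. Each corner contributes at most 1 to the rotation, so the
-- prefix rotations climb from at most 2 to 4 in unit steps and must pass through 2.

iter-+ : {A : Set} (f : A → A) (m n : ℕ) (x : A) → iter f (m + n) x ≡ iter f n (iter f m x)
iter-+ f zero    n x = refl
iter-+ f (suc m) n x = iter-+ f m n (f x)

iter-injective : {A : Set} (f : A → A) → (∀ {x y} → f x ≡ f y → x ≡ y) →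
                 ∀ k {x y} → iter f k x ≡ iter f k y → x ≡ y
iter-injective f f-inj zero    eq = eq
iter-injective f f-inj (suc k) eq = f-inj (iter-injective f f-inj k eq)

module _ {P : ℕ → Set} (P? : Decidable P) where

  LeastWitness : Set
  LeastWitness = ∃[ k ] (P k × (∀ {j} → j < k → ¬ P j))

  least-witness : ∀ {m} → P m → LeastWitness
  least-witness {m} = <-rec (λ m → P m → LeastWitness) smaller-or-least m
    where
    smaller-or-least : ∀ m → (∀ {j} → j < m → P j → LeastWitness) → P m → LeastWitness
    smaller-or-least m rec pm with ℕₚ.anyUpTo? P? m
    ... | yes (j , j<m , pj) = rec j<m pj
    ... | no none            = m , pm , λ j<m pj → none (_ , j<m , pj)

intermediate-value : (R : ℕ → ℤ) → (∀ j → R (suc j) ℤ.≤ ℤ.suc (R j)) →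
                     ∀ {c i} n → i ≤ n → R i ℤ.≤ c → c ℤ.< R n →
                     ∃[ j ] (i ≤ j × j < n × R j ≡ c)
intermediate-value R climb zero    z≤n Ri≤c c<Rn = contradiction Ri≤c (ℤₚ.<⇒≱ c<Rn)
intermediate-value R climb {c} {i} (suc n) i≤1+n Ri≤c c<R[1+n] with ℕₚ.m≤n⇒m<n∨m≡n i≤1+n
... | inj₂ refl = contradiction Ri≤c (ℤₚ.<⇒≱ c<R[1+n])
... | inj₁ i<1+n with c ℤₚ.<? R n
...   | yes c<Rn =
        let j , i≤j , j<n , Rj≡c = intermediate-value R climb n (ℕₚ.≤-pred i<1+n) Ri≤c c<Rn
        in j , i≤j , ℕₚ.m≤n⇒m≤1+n j<n , Rj≡c
...   | no c≮Rn = n , ℕₚ.≤-pred i<1+n , ℕₚ.n<1+n n , ℤₚ.≤-antisym (ℤₚ.≮⇒≥ c≮Rn) c≤Rn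
  where
  c≤Rn : c ℤ.≤ R n
  c≤Rn = subst (c ℤ.≤_) (ℤₚ.pred-suc (R n))
           (ℤₚ.i<j⇒i≤pred[j] (ℤₚ.<-≤-trans c<R[1+n] (climb n)))

sumℤ-↭ : ∀ {xs ys : List ℤ} → xs ↭ ys → sumℤ xs ≡ sumℤ ys
sumℤ-↭ p = foldr-commMonoid (setoid ℤ) ℤₚ.+-0-isCommutativeMonoid (↭⇒↭ₛ p)

module BoundaryWalk (G : PlaneGraph) where
  open PlaneGraph G

  next-injective : ∀ {x y} → next x ≡ next y → x ≡ y
  next-injective {x} {y} eq = begin
    x             ≡⟨ rev-invol x ⟨
    rev (rev x)   ≡⟨ cong rev rev-x≡rev-y ⟩
    rev (rev y)   ≡⟨ rev-invol y ⟩
    y             ∎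
    where
    open ≡-Reasoning
    rev-x≡rev-y : rev x ≡ rev y
    rev-x≡rev-y = trans (sym (σ⁻¹σ (rev x))) (trans (cong σ⁻¹ eq) (σ⁻¹σ (rev y)))

  faceOf-iter : ∀ k d → faceOf (iter next k d) ≡ faceOf d
  faceOf-iter zero    d = refl
  faceOf-iter (suc k) d = trans (faceOf-iter k (next d)) (faceOf-next d)

  module Orbit (d : Fin nD) where

    walk : ℕ → Fin nD
    walk k = iter next k d

    private
      least-return : ∃[ k ] (walk (suc k) ≡ d × (∀ {j} → j < k → walk (suc j) ≢ d))
      least-return =
        let k , walk[k]≡d = face-transitive (next d) d (faceOf-next d)
        in least-witness (λ k → walk (suc k) ≟ d) {k} walk[k]≡d

    period : ℕ
    period = suc (proj₁ least-return)

    walk-period : walk period ≡ d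
    walk-period = proj₁ (proj₂ least-return)

    walk-multiple-of-period : ∀ m → walk (m * period) ≡ d
    walk-multiple-of-period zero    = refl
    walk-multiple-of-period (suc m) =
      trans (iter-+ next period (m * period) d)
            (trans (cong (iter next (m * period)) walk-period) (walk-multiple-of-period m))

    walk-covers-face : ∀ d′ → faceOf d′ ≡ faceOf d → ∃[ r ] (r < period × walk r ≡ d′)
    walk-covers-face d′ same-face =
      let k , walk[k]≡d′ = face-transitive d d′ (sym same-face)
      in k % period , m%n<n k period , (begin
        walk (k % period)                                         ≡⟨ cong (iter next (k % period)) (walk-multiple-of-period (k / period)) ⟨
        iter next (k % period) (walk ((k / period) * period))     ≡⟨ iter-+ next ((k / period) * period) (k % period) d ⟨
        walk ((k / period) * period + k % period)                 ≡⟨ cong walk (ℕₚ.+-comm ((k / period) * period) (k % period)) ⟩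
        walk (k % period + (k / period) * period)                 ≡⟨ cong walk (m≡m%n+[m/n]*n k period) ⟨
        walk k                                                    ≡⟨ walk[k]≡d′ ⟩
        d′                                                        ∎)
      where open ≡-Reasoning

    walk-injective-below-period : ∀ {a b} → a < b → b < period → walk a ≢ walk b
    walk-injective-below-period {a} {b} a<b b<period walk[a]≡walk[b] =
      proj₂ (proj₂ least-return) c<k walk[1+c]≡d
      where
      open ≡-Reasoning
      c : ℕ
      c = b ∸ suc a
      a+[1+c]≡b : a + suc c ≡ b
      a+[1+c]≡b = trans (ℕₚ.+-suc a c) (ℕₚ.m+[n∸m]≡n a<b)
      c<k : c < proj₁ least-return
      c<k = ℕₚ.≤-trans (subst (suc c ≤_) a+[1+c]≡b (ℕₚ.m≤n+m (suc c) a)) (ℕₚ.≤-pred b<period)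
      walk[1+c]≡d : walk (suc c) ≡ d
      walk[1+c]≡d = iter-injective next next-injective a (begin
        iter next a (walk (suc c))   ≡⟨ iter-+ next (suc c) a d ⟨
        walk (suc c + a)             ≡⟨ cong walk (ℕₚ.+-comm (suc c) a) ⟩
        walk (a + suc c)             ≡⟨ cong walk a+[1+c]≡b ⟩
        walk b                       ≡⟨ walk[a]≡walk[b] ⟨
        walk a                       ∎)

    walk↭dartsOf : applyUpTo walk period ↭ dartsOf (faceOf d)
    walk↭dartsOf = ∼bag⇒↭ (unique∧set⇒bag unique-walk unique-darts (mk⇔ walk⊆darts darts⊆walk))
      where
      on-face? : Decidable (λ d′ → faceOf d′ ≡ faceOf d)
      on-face? d′ = faceOf d′ ≟ faceOf d

      unique-walk : Unique (applyUpTo walk period)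
      unique-walk = Unique.applyUpTo⁺₁ walk period walk-injective-below-period

      unique-darts : Unique (dartsOf (faceOf d))
      unique-darts = Unique.filter⁺ on-face? (Unique.allFin⁺ nD)

      walk⊆darts : ∀ {x} → x ∈ applyUpTo walk period → x ∈ dartsOf (faceOf d)
      walk⊆darts x∈walk with ∈-applyUpTo⁻ walk x∈walk
      ... | k , _ , refl = ∈-filter⁺ on-face? (∈-allFin (walk k)) (faceOf-iter k d)

      darts⊆walk : ∀ {x} → x ∈ dartsOf (faceOf d) → x ∈ applyUpTo walk period
      darts⊆walk {x} x∈darts with walk-covers-face x (proj₂ (∈-filter⁻ on-face? {xs = allFin nD} x∈darts))
      ... | r , r<period , refl = ∈-applyUpTo⁺ walk r<period

    period≡faceSize : period ≡ faceSize (faceOf d)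
    period≡faceSize = trans (sym (length-applyUpTo walk period)) (↭-length walk↭dartsOf)

module Rotation (G : PlaneGraph) (Γ : OrthoRadialRep G) where
  open PlaneGraph G
  open BoundaryWalk G

  rotCorner≤1 : ∀ d → rotCorner G Γ d ℤ.≤ + 1
  rotCorner≤1 d with next d ≟ rev d
  ... | yes _ = ℤ.-≤+
  ... | no _ with Γ d
  ...   | a90  = ℤ.+≤+ (s≤s z≤n)
  ...   | a180 = ℤ.+≤+ z≤n
  ...   | a270 = ℤ.-≤+
  ...   | a360 = ℤ.-≤+

  rotPrefix-suc : ∀ d j → rotPrefix G Γ d (suc j) ≡ rotPrefix G Γ d j ℤ.+ rotCorner G Γ (iter next j d)
  rotPrefix-suc d zero    = ℤₚ.+-comm (rotCorner G Γ d) (+ 0)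
  rotPrefix-suc d (suc j) =
    trans (cong (λ t → rotCorner G Γ d ℤ.+ t) (rotPrefix-suc (next d) j))
          (sym (ℤₚ.+-assoc (rotCorner G Γ d) _ _))

  rotPrefix-suc-≤ : ∀ d j → rotPrefix G Γ d (suc j) ℤ.≤ ℤ.suc (rotPrefix G Γ d j)
  rotPrefix-suc-≤ d j =
    subst₂ ℤ._≤_ (sym (rotPrefix-suc d j)) (ℤₚ.+-comm (rotPrefix G Γ d j) (+ 1))
      (ℤₚ.+-monoʳ-≤ (rotPrefix G Γ d j) (rotCorner≤1 (iter next j d)))

  rotPrefix≡sum : ∀ d k → rotPrefix G Γ d k ≡ sumℤ (map (rotCorner G Γ) (applyUpTo (λ i → iter next i d) k))
  rotPrefix≡sum d zero    = refl
  rotPrefix≡sum d (suc k) = cong (λ t → rotCorner G Γ d ℤ.+ t) (rotPrefix≡sum (next d) k)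

  rotPrefix-faceSize : ∀ d → rotPrefix G Γ d (faceSize (faceOf d)) ≡ faceRot G Γ (faceOf d)
  rotPrefix-faceSize d = begin
    rotPrefix G Γ d (faceSize (faceOf d))  ≡⟨ cong (rotPrefix G Γ d) period≡faceSize ⟨
    rotPrefix G Γ d period                 ≡⟨ rotPrefix≡sum d period ⟩
    sumℤ (map (rotCorner G Γ) (applyUpTo walk period))
                                           ≡⟨ sumℤ-↭ (map⁺ (rotCorner G Γ) walk↭dartsOf) ⟩
    faceRot G Γ (faceOf d)                 ∎
    where
    open ≡-Reasoning
    open Orbit d

  faceRot-regular : Condition2 G Γ → ∀ g → g ≢ outer → g ≢ central → faceRot G Γ g ≡ + 4
  faceRot-regular cond2 g g≢outer g≢central with faceRot G Γ g | cond2 g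
  ... | _ | regular _ _             = refl
  ... | _ | onlyOuter g≡outer _     = contradiction g≡outer g≢outer
  ... | _ | onlyCentral _ g≡central = contradiction g≡central g≢central
  ... | _ | both g≡outer _          = contradiction g≡outer g≢outer

lemma23 : (G : PlaneGraph) → Connected G → MaxDegree4 G →
          (Γ : OrthoRadialRep G) → Condition1 G Γ → Condition2 G Γ →
          (f : Fin (PlaneGraph.nF G)) → f ≢ PlaneGraph.outer G → f ≢ PlaneGraph.central G →
          (d₀ : Fin (PlaneGraph.nD G)) → PlaneGraph.faceOf G d₀ ≡ f →
          (i : ℕ) → i < PlaneGraph.faceSize G f →
          rotPrefix G Γ d₀ i ℤ.≤ + 2 →
          ∃[ j ] (i ≤ j × j < PlaneGraph.faceSize G f × rotPrefix G Γ d₀ j ≡ + 2)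
lemma23 G _ _ Γ _ cond2 f f≢outer f≢central d₀ refl i i<size rot[i]≤2 =
  intermediate-value (rotPrefix G Γ d₀) (rotPrefix-suc-≤ d₀) size (ℕₚ.<⇒≤ i<size) rot[i]≤2 2<full-turn
  where
  open PlaneGraph G using (faceSize)
  open Rotation G Γ
  size : ℕ
  size = faceSize f
  2<full-turn : + 2 ℤ.< rotPrefix G Γ d₀ size
  2<full-turn = subst (+ 2 ℤ.<_)
    (sym (trans (rotPrefix-faceSize d₀) (faceRot-regular cond2 f f≢outer f≢central)))
    (ℤ.+<+ (s≤s (s≤s (s≤s z≤n))))
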